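{- Let $G=(V,E)$ be a finite simple graph and $S\subseteq V$ with $|S|>\frac{|V|}{2}$. Let $u\in S$ be a vertex that has exactly two non-neighbors in $V\setminus\{u\}$, one of them in $S$ and the other in $\overline{S}=V\setminus S$. Then $u$ is satisfied with respect to $S$, i.e. $\frac{d_S(u)}{|S|-1}\ge \frac{d_{\overline{S}}(u)}{|\overline{S}|}$.
   Context: For $X\subseteq V$ and $v\in V$, $d_X(v)=|N(v)\cap X|$ where $N(v)$ is the neighborhood of $v$. A vertex $u\in S$ is satisfied with respect to $S$ if $\frac{d_S(u)}{|S|-1}\ge \frac{d_{\overline{S}}(u)}{|\overline{S}|}$. -}

module Defs where

open import Data.Bool using (Bool; true; false)
open import Data.Nat using (ℕ; _*_; _∸_; _≤_)
open import Data.Fin using (Fin)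
open import Data.Fin.Subset using (Subset; _∩_; ∣_∣)
open import Data.Vec using (tabulate)
open import Relation.Binary.PropositionalEquality using (_≡_)

record SimpleGraph (n : ℕ) : Set where
  field
    adj    : Fin n → Fin n → Bool
    sym    : ∀ u v → adj u v ≡ adj v u
    irrefl : ∀ v → adj v v ≡ false
open SimpleGraph public

N : ∀ {n} → SimpleGraph n → Fin n → Subset n
N G v = tabulate (adj G v)

deg : ∀ {n} → SimpleGraph n → Subset n → Fin n → ℕ
deg G X v = ∣ N G v ∩ X ∣

-- u ∈ S is satisfied w.r.t. S:  d_S(u)/(|S|-1) ≥ d_{S̄}(u)/|S̄|,
-- written with cleared (natural-number) denominators:
--   d_S(u) * |S̄| ≥ d_{S̄}(u) * (|S| - 1).
Satisfied : ∀ {n} → SimpleGraph n → Subset n → Fin n → Set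
Satisfied G S u =
  deg G (Data.Fin.Subset.∁ S) u * (∣ S ∣ ∸ 1) ≤ deg G S u * ∣ Data.Fin.Subset.∁ S ∣

-- The non-neighbourhood ∁ N(u), which contains u, meets S exactly in {u, a}
-- and S̄ exactly in {b}; hence d_S(u) = |S| − 2 and d_S̄(u) = |S̄| − 1.
-- Since |S̄| < |S|, d_S̄(u) ≤ d_S(u), and the cleared-denominator inequality
-- d_S̄(u) · (d_S(u) + 1) ≤ d_S(u) · (d_S̄(u) + 1) follows.
module Submission where

open import Defs hiding (sym)
open import Data.Bool using (true; false)
open import Data.Bool.Properties using (¬-not)
open import Data.Nat using (ℕ; zero; suc; _+_; _*_; _∸_; _≤_; _<_; s<s⁻¹)
open import Data.Nat.Properties
  using (+-suc; +-comm; +-identityʳ; *-suc; *-comm; +-monoˡ-≤; m<n+o⇒m∸n<o; m<1+n⇒m≤n; module ≤-Reasoning)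
open import Data.Fin using (Fin)
open import Data.Fin.Subset using (Subset; inside; outside; _∈_; _∉_; ∣_∣; _∩_; ∁; ⁅_⁆)
open import Data.Fin.Subset.Properties
  using (⊆-antisym; x∈⁅x⁆; x∈⁅y⁆⇒x≡y; ∣⁅x⁆∣≡1; x∈p∩q⁺; x∈p∩q⁻; x∈∁p⇒x∉p; x∉p⇒x∈∁p; ∣∁p∣≡n∸∣p∣)
open import Data.Fin.Properties using (_≟_)
open import Data.Vec using (_∷_; [])
open import Data.Vec.Properties using ([]=⇒lookup; lookup⇒[]=; lookup∘tabulate)
open import Data.Product using (_,_; proj₁)
open import Data.Sum using (_⊎_; inj₁; inj₂)
open import Function using (_∘_)
open import Relation.Nullary using (¬_; yes; no; contradiction)
open import Relation.Binary.PropositionalEquality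
  using (_≡_; _≢_; refl; sym; trans; cong; cong₂; subst; subst₂; module ≡-Reasoning)

private
  variable
    n : ℕ

m*[1+n]≤n*[1+m] : ∀ {m n} → m ≤ n → m * suc n ≤ n * suc m
m*[1+n]≤n*[1+m] {m} {n} m≤n = begin
  m * suc n  ≡⟨ *-suc m n ⟩
  m + m * n  ≤⟨ +-monoˡ-≤ (m * n) m≤n ⟩
  n + m * n  ≡⟨ cong (n +_) (*-comm m n) ⟩
  n + n * m  ≡⟨ *-suc n m ⟨
  n * suc m  ∎
  where open ≤-Reasoning

m<2*n⇒m∸n<n : ∀ m n → m < 2 * n → m ∸ n < n
m<2*n⇒m∸n<n m zero    ()
m<2*n⇒m∸n<n m (suc n) m<2n =
  m<n+o⇒m∸n<o m (suc n) (subst (m <_) (cong (suc n +_) (+-identityʳ (suc n))) m<2n)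

n<2∣p∣⇒∣∁p∣<∣p∣ : (p : Subset n) → n < 2 * ∣ p ∣ → ∣ ∁ p ∣ < ∣ p ∣
n<2∣p∣⇒∣∁p∣<∣p∣ {n} p n<2∣p∣ =
  subst (_< ∣ p ∣) (sym (∣∁p∣≡n∸∣p∣ p)) (m<2*n⇒m∸n<n n ∣ p ∣ n<2∣p∣)

∣p∩q∣+∣∁p∩q∣≡∣q∣ : (p q : Subset n) → ∣ p ∩ q ∣ + ∣ ∁ p ∩ q ∣ ≡ ∣ q ∣
∣p∩q∣+∣∁p∩q∣≡∣q∣ []            []            = refl
∣p∩q∣+∣∁p∩q∣≡∣q∣ (inside  ∷ p) (inside  ∷ q) = cong suc (∣p∩q∣+∣∁p∩q∣≡∣q∣ p q)
∣p∩q∣+∣∁p∩q∣≡∣q∣ (outside ∷ p) (inside  ∷ q) =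
  trans (+-suc ∣ p ∩ q ∣ ∣ ∁ p ∩ q ∣) (cong suc (∣p∩q∣+∣∁p∩q∣≡∣q∣ p q))
∣p∩q∣+∣∁p∩q∣≡∣q∣ (inside  ∷ p) (outside ∷ q) = ∣p∩q∣+∣∁p∩q∣≡∣q∣ p q
∣p∩q∣+∣∁p∩q∣≡∣q∣ (outside ∷ p) (outside ∷ q) = ∣p∩q∣+∣∁p∩q∣≡∣q∣ p q

only-x⇒∣p∣≡1 : {p : Subset n} {x : Fin n} →
  x ∈ p → (∀ {y} → y ∈ p → y ≡ x) → ∣ p ∣ ≡ 1
only-x⇒∣p∣≡1 {p = p} {x} x∈p only = trans (cong ∣_∣ p≡⁅x⁆) (∣⁅x⁆∣≡1 x)
  where
  p≡⁅x⁆ : p ≡ ⁅ x ⁆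
  p≡⁅x⁆ = ⊆-antisym
    (λ y∈p → subst (_∈ ⁅ x ⁆) (sym (only y∈p)) (x∈⁅x⁆ x))
    (λ y∈⁅x⁆ → subst (_∈ p) (sym (x∈⁅y⁆⇒x≡y x y∈⁅x⁆)) x∈p)

only-x-y⇒∣p∣≡2 : {p : Subset n} {x y : Fin n} → y ≢ x →
  x ∈ p → y ∈ p → (∀ {z} → z ∈ p → z ≡ x ⊎ z ≡ y) → ∣ p ∣ ≡ 2
only-x-y⇒∣p∣≡2 {p = p} {x} {y} y≢x x∈p y∈p only = begin
  ∣ p ∣                           ≡⟨ ∣p∩q∣+∣∁p∩q∣≡∣q∣ ⁅ x ⁆ p ⟨
  ∣ ⁅ x ⁆ ∩ p ∣ + ∣ ∁ ⁅ x ⁆ ∩ p ∣  ≡⟨ cong₂ _+_ (only-x⇒∣p∣≡1 x∈⁅x⁆∩p onlyˡ) (only-x⇒∣p∣≡1 y∈∁⁅x⁆∩p onlyʳ) ⟩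
  2                               ∎
  where
  open ≡-Reasoning
  x∈⁅x⁆∩p : x ∈ ⁅ x ⁆ ∩ p
  x∈⁅x⁆∩p = x∈p∩q⁺ (x∈⁅x⁆ x , x∈p)
  y∈∁⁅x⁆∩p : y ∈ ∁ ⁅ x ⁆ ∩ p
  y∈∁⁅x⁆∩p = x∈p∩q⁺ (x∉p⇒x∈∁p (y≢x ∘ x∈⁅y⁆⇒x≡y x) , y∈p)
  onlyˡ : ∀ {z} → z ∈ ⁅ x ⁆ ∩ p → z ≡ x
  onlyˡ = x∈⁅y⁆⇒x≡y x ∘ proj₁ ∘ x∈p∩q⁻ ⁅ x ⁆ p
  onlyʳ : ∀ {z} → z ∈ ∁ ⁅ x ⁆ ∩ p → z ≡ y
  onlyʳ z∈ with x∈p∩q⁻ (∁ ⁅ x ⁆) p z∈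
  ... | z∈∁⁅x⁆ , z∈p with only z∈p
  ...   | inj₁ refl = contradiction (x∈⁅x⁆ x) (x∈∁p⇒x∉p z∈∁⁅x⁆)
  ...   | inj₂ z≡y  = z≡y

module _ (G : SimpleGraph n) {v w : Fin n} where

  ∈N⇒adj : w ∈ N G v → adj G v w ≡ true
  ∈N⇒adj w∈N = trans (sym (lookup∘tabulate (adj G v) w)) ([]=⇒lookup w∈N)

  adj⇒∈N : adj G v w ≡ true → w ∈ N G v
  adj⇒∈N e = lookup⇒[]= w (N G v) (trans (lookup∘tabulate (adj G v) w) e)

  ¬adj⇒∈∁N : adj G v w ≡ false → w ∈ ∁ (N G v)
  ¬adj⇒∈∁N e = x∉p⇒x∈∁p (λ w∈N → contradiction (trans (sym (∈N⇒adj w∈N)) e) λ ())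

  ∈∁N⇒¬adj : w ∈ ∁ (N G v) → adj G v w ≡ false
  ∈∁N⇒¬adj w∈∁N = ¬-not (x∈∁p⇒x∉p w∈∁N ∘ adj⇒∈N)

module TwoNonNeighbours
  (G : SimpleGraph n) (S : Subset n) {u a b : Fin n}
  (u∈S : u ∈ S) (a∈S : a ∈ S) (b∉S : b ∉ S) (a≢u : a ≢ u)
  (¬adj-ua : adj G u a ≡ false) (¬adj-ub : adj G u b ≡ false)
  (only-a-b : ∀ w → w ≢ u → adj G u w ≡ false → w ≡ a ⊎ w ≡ b)
  where

  u∈∁N : u ∈ ∁ (N G u)
  u∈∁N = ¬adj⇒∈∁N G (irrefl G u)

  ∈∁N⇒u⊎a⊎b : ∀ {w} → w ∈ ∁ (N G u) → w ≡ u ⊎ w ≡ a ⊎ w ≡ b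
  ∈∁N⇒u⊎a⊎b {w} w∈∁N with w ≟ u
  ... | yes w≡u = inj₁ w≡u
  ... | no  w≢u = inj₂ (only-a-b w w≢u (∈∁N⇒¬adj G w∈∁N))

  ∣∁N∩S∣≡2 : ∣ ∁ (N G u) ∩ S ∣ ≡ 2
  ∣∁N∩S∣≡2 = only-x-y⇒∣p∣≡2 a≢u
    (x∈p∩q⁺ (u∈∁N , u∈S)) (x∈p∩q⁺ (¬adj⇒∈∁N G ¬adj-ua , a∈S)) u⊎a
    where
    u⊎a : ∀ {w} → w ∈ ∁ (N G u) ∩ S → w ≡ u ⊎ w ≡ a
    u⊎a w∈ with x∈p∩q⁻ (∁ (N G u)) S w∈
    ... | w∈∁N , w∈S with ∈∁N⇒u⊎a⊎b w∈∁N
    ...   | inj₁ w≡u        = inj₁ w≡u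
    ...   | inj₂ (inj₁ w≡a) = inj₂ w≡a
    ...   | inj₂ (inj₂ refl) = contradiction w∈S b∉S

  ∣∁N∩∁S∣≡1 : ∣ ∁ (N G u) ∩ ∁ S ∣ ≡ 1
  ∣∁N∩∁S∣≡1 = only-x⇒∣p∣≡1 (x∈p∩q⁺ (¬adj⇒∈∁N G ¬adj-ub , x∉p⇒x∈∁p b∉S)) only-b
    where
    only-b : ∀ {w} → w ∈ ∁ (N G u) ∩ ∁ S → w ≡ b
    only-b w∈ with x∈p∩q⁻ (∁ (N G u)) (∁ S) w∈
    ... | w∈∁N , w∈∁S with ∈∁N⇒u⊎a⊎b w∈∁N
    ...   | inj₁ refl        = contradiction u∈S (x∈∁p⇒x∉p w∈∁S)
    ...   | inj₂ (inj₁ refl) = contradiction a∈S (x∈∁p⇒x∉p w∈∁S)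
    ...   | inj₂ (inj₂ w≡b)  = w≡b

  ∣S∣≡2+d : ∣ S ∣ ≡ 2 + deg G S u
  ∣S∣≡2+d = begin
    ∣ S ∣                                     ≡⟨ ∣p∩q∣+∣∁p∩q∣≡∣q∣ (N G u) S ⟨
    deg G S u + ∣ ∁ (N G u) ∩ S ∣             ≡⟨ cong (deg G S u +_) ∣∁N∩S∣≡2 ⟩
    deg G S u + 2                             ≡⟨ +-comm (deg G S u) 2 ⟩
    2 + deg G S u                             ∎
    where open ≡-Reasoning

  ∣∁S∣≡1+d : ∣ ∁ S ∣ ≡ 1 + deg G (∁ S) u
  ∣∁S∣≡1+d = begin
    ∣ ∁ S ∣                                   ≡⟨ ∣p∩q∣+∣∁p∩q∣≡∣q∣ (N G u) (∁ S) ⟨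
    deg G (∁ S) u + ∣ ∁ (N G u) ∩ ∁ S ∣       ≡⟨ cong (deg G (∁ S) u +_) ∣∁N∩∁S∣≡1 ⟩
    deg G (∁ S) u + 1                         ≡⟨ +-comm (deg G (∁ S) u) 1 ⟩
    1 + deg G (∁ S) u                         ∎
    where open ≡-Reasoning

lemma4 : (n : ℕ) (G : SimpleGraph n) (S : Subset n) →
    n < 2 * ∣ S ∣ →
    (u : Fin n) → u ∈ S →
    (a b : Fin n) → a ∈ S → b ∉ S → ¬ (a ≡ u) →
    adj G u a ≡ false → adj G u b ≡ false →
    (∀ w → ¬ (w ≡ u) → adj G u w ≡ false → (w ≡ a) ⊎ (w ≡ b)) →
    Satisfied G S u
lemma4 n G S n<2∣S∣ u u∈S a b a∈S b∉S a≢u ¬adj-ua ¬adj-ub only-a-b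
  = subst₂ (λ s s̄ → deg G (∁ S) u * (s ∸ 1) ≤ deg G S u * s̄)
      (sym ∣S∣≡2+d) (sym ∣∁S∣≡1+d) (m*[1+n]≤n*[1+m] d∁S≤dS)
  where
  open TwoNonNeighbours G S u∈S a∈S b∉S a≢u ¬adj-ua ¬adj-ub only-a-b
  d∁S≤dS : deg G (∁ S) u ≤ deg G S u
  d∁S≤dS = m<1+n⇒m≤n (s<s⁻¹
    (subst₂ _<_ ∣∁S∣≡1+d ∣S∣≡2+d (n<2∣p∣⇒∣∁p∣<∣p∣ S n<2∣S∣)))
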